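{- Let $F$ be an $\mathrm{A}$-frame and $G$ a $\mathrm{B}$-frame ($\mathrm{A},\mathrm{B}$ disjoint finite alphabets). If $h(F)=h_1$ and $h(G)=h_2$ for finite $h_1,h_2$, then $h(F\times G)=h_1+h_2-1$.
   Context: For a frame $F$ with relations $(R_\lozenge)$, let $R_F$ be their union and $R_F^*$ its reflexive transitive closure; $\sim_F=R_F^*\cap(R_F^*)^{ -1}$. The skeleton of $F$ is the poset of $\sim_F$-classes ordered by $[a]\le[b]$ iff $aR_F^*b$. $F$ has finite height $h$, written $h(F)=h$, if its skeleton contains a chain of $h$ elements and no chain of more than $h$ elements. $F\times G$ (on $X\times Y$) has, for each relation $R$ of $F$, the relation $(a,b)R^h(a',b)$ iff $aRa'$, and for each relation $S$ of $G$, $(a,b)S^v(a,b')$ iff $bSb'$. -}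

module Defs where

open import Data.Nat using (ℕ; _≤_)
open import Data.Fin using (Fin)
open import Data.Sum using (_⊎_; inj₁; inj₂)
open import Data.Product using (Σ; _×_; _,_; ∃)
open import Relation.Nullary using (¬_)
open import Relation.Binary.PropositionalEquality using (_≡_; _≢_)
open import Relation.Binary.Construct.Closure.ReflexiveTransitive using (Star)

record Frame (A : Set) : Set₁ where
  field
    World : Set
    Rel   : A → World → World → Set
open Frame public

RU : {A : Set} (F : Frame A) → World F → World F → Set
RU {A} F x y = Σ A λ a → Rel F a x y

R* : {A : Set} (F : Frame A) → World F → World F → Set
R* F = Star (RU F)

Equiv : {A : Set} (F : Frame A) → World F → World F → Set
Equiv F x y = R* F x y × R* F y x

-- A chain of k elements in the skeleton of F, given by representatives
-- f i of k pairwise distinct ~_F-classes that are pairwise comparable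
-- in the skeleton order ([a] ≤ [b] iff a R_F^* b).
SkelChain : {A : Set} (F : Frame A) (k : ℕ) → Set
SkelChain F k =
  Σ (Fin k → World F) λ f →
    (i j : Fin k) → i ≢ j →
      (¬ Equiv F (f i) (f j)) × (R* F (f i) (f j) ⊎ R* F (f j) (f i))

HasChain : {A : Set} (F : Frame A) (k : ℕ) → Set
HasChain F k = SkelChain F k

HeightIs : {A : Set} (F : Frame A) (h : ℕ) → Set
HeightIs F h = HasChain F h × ((k : ℕ) → HasChain F k → k ≤ h)

_⊗_ : {A B : Set} → Frame A → Frame B → Frame (A ⊎ B)
World (F ⊗ G) = World F × World G
Rel (F ⊗ G) (inj₁ a) (x , y) (x' , y') = Rel F a x x' × y ≡ y'
Rel (F ⊗ G) (inj₂ b) (x , y) (x' , y') = x ≡ x' × Rel G b y y'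

-- A strictly ascending chain in F ⊗ G moves, at each step, strictly up in at
-- least one coordinate; sorting each step into the coordinate(s) where it is
-- strict splits a product chain of k elements into chains of a elements in F
-- and b elements in G with k < a + b, since the first point is counted in both.
-- Conversely, climbing a maximal chain of F and then one of G from its top
-- gives h₁ + h₂ - 1 elements. The case split "strict or not" is classical, so
-- the splitting is carried out under a double negation, which is harmless
-- because the conclusion k ≤ h₁ + h₂ ∸ 1 is decidable.
module Submission where

open import Defs
open import Data.Nat using (ℕ; _+_; _∸_; zero; suc; _≤_; _<_; z≤n; s≤s; _≤?_)
open import Data.Nat.Properties using (+-suc; +-mono-≤; ∸-monoˡ-≤; ≤-trans; m≤n⇒m≤1+n)
open import Data.Fin using (Fin; zero; suc; punchIn)
open import Data.Fin.Properties using (punchInᵢ≢i; punchIn-injective; suc-injective; _≟_)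
open import Data.Product using (Σ; ∃; _×_; _,_; proj₁; proj₂)
open import Data.Sum using (_⊎_; inj₁; inj₂)
open import Data.Empty using (⊥-elim)
open import Relation.Nullary using (¬_; Dec; yes; no)
open import Relation.Nullary.Decidable using (decidable-stable; ¬¬-excluded-middle)
open import Relation.Nullary.Negation using (¬¬-Monad; ¬¬-map)
open import Relation.Binary.PropositionalEquality using (_≢_; refl; sym; cong; subst)
open import Relation.Binary.Construct.Closure.ReflexiveTransitive using (ε; _◅_; _◅◅_)
open import Effect.Monad using (RawMonad)
open import Function using (_∘_)
open import Level using (0ℓ)

module Skeleton {A : Set} (F : Frame A) where

  _⊏_ : World F → World F → Set
  x ⊏ y = R* F x y × ¬ R* F y x

  R*-⊏-trans : ∀ {x y z} → R* F x y → y ⊏ z → x ⊏ z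
  R*-⊏-trans xy (yz , ¬zy) = xy ◅◅ yz , λ zx → ¬zy (zx ◅◅ xy)

  ⊏-trans : ∀ {x y z} → x ⊏ y → y ⊏ z → x ⊏ z
  ⊏-trans (xy , _) = R*-⊏-trans xy

  data Chain : World F → ℕ → Set where
    [_] : ∀ x → Chain x 1
    _∷_ : ∀ {x y n} → x ⊏ y → Chain y n → Chain x (suc n)

  infixr 5 _∷_

  lookup : ∀ {x n} → Chain x n → Fin n → World F
  lookup [ x ]         zero    = x
  lookup (_∷_ {x} _ _) zero    = x
  lookup (_ ∷ c)       (suc i) = lookup c i

  top : ∀ {x n} → Chain x n → World F
  top [ x ]   = x
  top (_ ∷ c) = top c

  Chain-startFrom : ∀ {x' x n} → R* F x' x → Chain x n → Chain x' n
  Chain-startFrom _   [ _ ]    = [ _ ]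
  Chain-startFrom x'x (xy ∷ c) = R*-⊏-trans x'x xy ∷ c

  Comparable : ∀ k → (Fin k → World F) → Set
  Comparable k f = (i j : Fin k) → i ≢ j → f i ⊏ f j ⊎ f j ⊏ f i

  head⊏lookup : ∀ {x y n} → x ⊏ y → (c : Chain y n) (j : Fin n) → x ⊏ lookup c j
  head⊏lookup x⊏y [ _ ]     zero    = x⊏y
  head⊏lookup x⊏y (_ ∷ _)   zero    = x⊏y
  head⊏lookup x⊏y (y⊏z ∷ c) (suc j) = ⊏-trans x⊏y (head⊏lookup y⊏z c j)

  lookup-comparable : ∀ {x n} (c : Chain x n) → Comparable n (lookup c)
  lookup-comparable c        zero    zero    i≢j = ⊥-elim (i≢j refl)
  lookup-comparable (x⊏ ∷ c) zero    (suc j) _   = inj₁ (head⊏lookup x⊏ c j)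
  lookup-comparable (x⊏ ∷ c) (suc i) zero    _   = inj₂ (head⊏lookup x⊏ c i)
  lookup-comparable (_ ∷ c)  (suc i) (suc j) i≢j = lookup-comparable c i j (i≢j ∘ cong suc)

  SkeletonComparable : World F → World F → Set
  SkeletonComparable x y = ¬ Equiv F x y × (R* F x y ⊎ R* F y x)

  ⊏⊎⊐⇒SkeletonComparable : ∀ {x y} → x ⊏ y ⊎ y ⊏ x → SkeletonComparable x y
  ⊏⊎⊐⇒SkeletonComparable (inj₁ (xy , ¬yx)) = (¬yx ∘ proj₂) , inj₁ xy
  ⊏⊎⊐⇒SkeletonComparable (inj₂ (yx , ¬xy)) = (¬xy ∘ proj₁) , inj₂ yx

  SkeletonComparable⇒⊏⊎⊐ : ∀ {x y} → SkeletonComparable x y → x ⊏ y ⊎ y ⊏ x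
  SkeletonComparable⇒⊏⊎⊐ (¬x∼y , inj₁ xy) = inj₁ (xy , λ yx → ¬x∼y (xy , yx))
  SkeletonComparable⇒⊏⊎⊐ (¬x∼y , inj₂ yx) = inj₂ (yx , λ xy → ¬x∼y (xy , yx))

  Chain⇒SkelChain : ∀ {x n} → Chain x n → SkelChain F n
  Chain⇒SkelChain c = lookup c , λ i j i≢j → ⊏⊎⊐⇒SkeletonComparable (lookup-comparable c i j i≢j)

  least : ∀ k (f : Fin (suc k) → World F) → Comparable (suc k) f →
          Σ (Fin (suc k)) λ m → ∀ j → j ≢ m → f m ⊏ f j
  least zero f _ = zero , only-zero
    where
    only-zero : ∀ j → j ≢ zero → f zero ⊏ f j
    only-zero zero j≢0 = ⊥-elim (j≢0 refl)
  least (suc k) f cmp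
    with m , m-least ← least k (f ∘ suc) (λ i j i≢j → cmp (suc i) (suc j) (i≢j ∘ suc-injective))
    with cmp zero (suc m) (λ ())
  ... | inj₁ f0⊏fm = zero , zero-least
    where
    zero-least : ∀ j → j ≢ zero → f zero ⊏ f j
    zero-least zero    j≢0 = ⊥-elim (j≢0 refl)
    zero-least (suc j) _   with j ≟ m
    ... | yes refl = f0⊏fm
    ... | no  j≢m  = ⊏-trans f0⊏fm (m-least j j≢m)
  ... | inj₂ fm⊏f0 = suc m , suc-m-least
    where
    suc-m-least : ∀ j → j ≢ suc m → f (suc m) ⊏ f j
    suc-m-least zero    _    = fm⊏f0
    suc-m-least (suc j) j≢sm = m-least j (j≢sm ∘ cong suc)

  sort : ∀ k (f : Fin (suc k) → World F) → Comparable (suc k) f →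
         Σ (Fin (suc k)) λ i → Chain (f i) (suc k)
  sort zero f _ = zero , [ f zero ]
  sort (suc k) f cmp
    with m , m-least ← least (suc k) f cmp
    with i , c ← sort k (f ∘ punchIn m) (λ i j i≢j → cmp _ _ (i≢j ∘ punchIn-injective m i j))
    = m , m-least (punchIn m i) (punchInᵢ≢i m i) ∷ c

  SkelChain⇒Chain : ∀ k → SkelChain F (suc k) → ∃ λ x → Chain x (suc k)
  SkelChain⇒Chain k (f , cmp) with i , c ← sort k f (λ i j i≢j → SkeletonComparable⇒⊏⊎⊐ (cmp i j i≢j))
    = f i , c

  ¬HeightIs0 : World F → ¬ HeightIs F 0
  ¬HeightIs0 x (_ , maximal) with () ← maximal 1 ((λ _ → x) , λ { zero zero 0≢0 → ⊥-elim (0≢0 refl) })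

module Product {A B : Set} (F : Frame A) (G : Frame B) where

  open Skeleton using (Chain; [_]; _∷_; top; Chain-startFrom; Chain⇒SkelChain; SkelChain⇒Chain)
  open Skeleton F using () renaming (_⊏_ to _⊏ᶠ_)
  open Skeleton G using () renaming (_⊏_ to _⊏ᵍ_)
  open Skeleton (F ⊗ G) using () renaming (_⊏_ to _⊏ᵖ_)

  R*-proj₁ : ∀ {p q} → R* (F ⊗ G) p q → R* F (proj₁ p) (proj₁ q)
  R*-proj₁ ε                           = ε
  R*-proj₁ ((inj₁ a , xx' , refl) ◅ s) = (a , xx') ◅ R*-proj₁ s
  R*-proj₁ ((inj₂ _ , refl , _)   ◅ s) = R*-proj₁ s

  R*-proj₂ : ∀ {p q} → R* (F ⊗ G) p q → R* G (proj₂ p) (proj₂ q)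
  R*-proj₂ ε                           = ε
  R*-proj₂ ((inj₁ _ , _ , refl)   ◅ s) = R*-proj₂ s
  R*-proj₂ ((inj₂ b , refl , yy') ◅ s) = (b , yy') ◅ R*-proj₂ s

  R*-horizontal : ∀ {x x' y} → R* F x x' → R* (F ⊗ G) (x , y) (x' , y)
  R*-horizontal ε             = ε
  R*-horizontal ((a , r) ◅ s) = (inj₁ a , r , refl) ◅ R*-horizontal s

  R*-vertical : ∀ {x y y'} → R* G y y' → R* (F ⊗ G) (x , y) (x , y')
  R*-vertical ε             = ε
  R*-vertical ((b , r) ◅ s) = (inj₂ b , refl , r) ◅ R*-vertical s

  ⊏-horizontal : ∀ {x x' y} → x ⊏ᶠ x' → (x , y) ⊏ᵖ (x' , y)
  ⊏-horizontal (xx' , ¬x'x) = R*-horizontal xx' , ¬x'x ∘ R*-proj₁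

  ⊏-vertical : ∀ {x y y'} → y ⊏ᵍ y' → (x , y) ⊏ᵖ (x , y')
  ⊏-vertical (yy' , ¬y'y) = R*-vertical yy' , ¬y'y ∘ R*-proj₂

  Chain-vertical : ∀ {x y n} → Chain G y n → Chain (F ⊗ G) (x , y) n
  Chain-vertical [ _ ]     = [ _ ]
  Chain-vertical (y⊏ ∷ c) = ⊏-vertical y⊏ ∷ Chain-vertical c

  Chain-horizontal-++ : ∀ {x y n m} (c : Chain F x (suc n)) →
                        Chain (F ⊗ G) (top F c , y) m → Chain (F ⊗ G) (x , y) (n + m)
  Chain-horizontal-++             [ _ ]    d = d
  Chain-horizontal-++ {n = suc _} (x⊏ ∷ c) d = ⊏-horizontal x⊏ ∷ Chain-horizontal-++ c d
  Chain-horizontal-++ {n = zero}  (_ ∷ ())  _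

  Splitting : World (F ⊗ G) → ℕ → Set
  Splitting (x , y) k = Σ ℕ λ a → Σ ℕ λ b → Chain F x a × Chain G y b × k < a + b

  Splitting-cons : ∀ {p q k} → p ⊏ᵖ q → Splitting q k →
                   Dec (R* F (proj₁ q) (proj₁ p)) → Dec (R* G (proj₂ q) (proj₂ p)) →
                   Splitting p (suc k)
  Splitting-cons (_ , ¬qp) _ (yes qp₁) (yes qp₂) = ⊥-elim (¬qp (R*-horizontal qp₁ ◅◅ R*-vertical qp₂))
  Splitting-cons {k = k} (pq , _) (a , b , c , d , k<a+b) (yes _) (no ¬qp₂) =
    a , suc b , Chain-startFrom F (R*-proj₁ pq) c , (R*-proj₂ pq , ¬qp₂) ∷ d ,
    subst (suc k <_) (sym (+-suc a b)) (s≤s k<a+b)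
  Splitting-cons (pq , _) (a , b , c , d , k<a+b) (no ¬qp₁) (yes _) =
    suc a , b , (R*-proj₁ pq , ¬qp₁) ∷ c , Chain-startFrom G (R*-proj₂ pq) d , s≤s k<a+b
  Splitting-cons {k = k} (pq , _) (a , b , c , d , k<a+b) (no ¬qp₁) (no ¬qp₂) =
    suc a , suc b , (R*-proj₁ pq , ¬qp₁) ∷ c , (R*-proj₂ pq , ¬qp₂) ∷ d ,
    s≤s (subst (suc k ≤_) (sym (+-suc a b)) (m≤n⇒m≤1+n k<a+b))

  open RawMonad (¬¬-Monad {a = 0ℓ}) using (pure; _>>=_)

  split : ∀ {p k} → Chain (F ⊗ G) p k → ¬ ¬ Splitting p k
  split [ _ ] = pure (1 , 1 , [ _ ] , [ _ ] , s≤s (s≤s z≤n))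
  split (p⊏q ∷ c) = do
    s  ← split c
    d₁ ← ¬¬-excluded-middle
    d₂ ← ¬¬-excluded-middle
    pure (Splitting-cons p⊏q s d₁ d₂)

  HasChain-⊗ : ∀ a b → HasChain F (suc a) → HasChain G (suc b) → HasChain (F ⊗ G) (suc a + suc b ∸ 1)
  HasChain-⊗ a b cf cg with _ , c ← SkelChain⇒Chain F a cf | _ , d ← SkelChain⇒Chain G b cg =
    Chain⇒SkelChain (F ⊗ G) (Chain-horizontal-++ c (Chain-vertical d))

  HasChain-⊗-≤ : ∀ {h₁ h₂} → HeightIs F h₁ → HeightIs G h₂ →
                 ∀ k → HasChain (F ⊗ G) k → k ≤ h₁ + h₂ ∸ 1
  HasChain-⊗-≤ _ _ zero _ = z≤n
  HasChain-⊗-≤ {h₁} {h₂} (_ , maxF) (_ , maxG) (suc k) ch with p , c ← SkelChain⇒Chain (F ⊗ G) k ch =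
    decidable-stable (suc k ≤? h₁ + h₂ ∸ 1) (¬¬-map bound (split c))
    where
    bound : Splitting p (suc k) → suc k ≤ h₁ + h₂ ∸ 1
    bound (a , b , c , d , k<a+b) =
      ∸-monoˡ-≤ 1 (≤-trans k<a+b (+-mono-≤ (maxF a (Chain⇒SkelChain F c)) (maxG b (Chain⇒SkelChain G d))))

proposition3p6 : (m n : ℕ) (F : Frame (Fin m)) (G : Frame (Fin n))
    → World F → World G
    → (h₁ h₂ : ℕ) → HeightIs F h₁ → HeightIs G h₂
    → HeightIs (F ⊗ G) (h₁ + h₂ ∸ 1)
proposition3p6 _ _ F _ x _ zero    _       HF _  = ⊥-elim (Skeleton.¬HeightIs0 F x HF)
proposition3p6 _ _ _ G _ y _       zero    _  HG = ⊥-elim (Skeleton.¬HeightIs0 G y HG)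
proposition3p6 _ _ F G _ _ (suc a) (suc b) HF HG =
  Product.HasChain-⊗ F G a b (proj₁ HF) (proj₁ HG) , Product.HasChain-⊗-≤ F G HF HG
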